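{- Let $t\ge 2$ and let $2\le n_1\le n_2\le\cdots\le n_t$ be integers with $n_2\ge 3$, and additionally $n_1\ge 3$ if $t=2$. Then $$(n_1-1)(n_2-1)\cdots(n_t-1)\ge 2\log_2(n_1n_2\cdots n_t)$$ unless either $t=2$ and $(n_1,n_2)\in\{(3,3),(3,4)\}$, or $t=3$ and $(n_1,n_2,n_3)\in\{(2,3,3),(2,3,4),(2,3,5),(2,3,6),(2,4,4),(3,3,3)\}$, or $t=4$ and $(n_1,n_2,n_3,n_4)\in\{(2,3,3,3),(2,3,3,4)\}$. -}

module Defs where

open import Data.Nat using (ℕ; _∸_)
open import Data.List using (List; []; _∷_)

exceptions : List (List ℕ)
exceptions =
    (3 ∷ 3 ∷ []) ∷ (3 ∷ 4 ∷ []) ∷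
    (2 ∷ 3 ∷ 3 ∷ []) ∷ (2 ∷ 3 ∷ 4 ∷ []) ∷ (2 ∷ 3 ∷ 5 ∷ []) ∷
    (2 ∷ 3 ∷ 6 ∷ []) ∷ (2 ∷ 4 ∷ 4 ∷ []) ∷ (3 ∷ 3 ∷ 3 ∷ []) ∷
    (2 ∷ 3 ∷ 3 ∷ 3 ∷ []) ∷ (2 ∷ 3 ∷ 3 ∷ 4 ∷ []) ∷ []

module Submission where

-- Write P = ∏ nᵢ and S = ∏ (nᵢ − 1); the claim is P² ≤ 2^S.  Raising one entry
-- from n to n + 1 multiplies P² by ((n+1)/n)² ≤ 4 and 2^S by 2^S′, where S′ is
-- the product of the other (nⱼ − 1); so once S′ ≥ 2, raising any entry preserves
-- the bound.  Similarly, inserting a new entry 3 multiplies P² by 9 and squares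
-- 2^S, which is harmless once S ≥ 4.  Hence every non-exceptional tuple is reached
-- from one of finitely many small tuples, on which the bound is checked by
-- evaluation.

open import Defs
open import Data.Nat using (ℕ; _≤_; _^_; _∸_)
open import Data.List using (List; []; _∷_; map)
open import Data.Nat.ListAction using (product)
open import Data.List.Relation.Unary.Linked using (Linked)
open import Data.List.Membership.Propositional using (_∈_)
open import Relation.Binary.PropositionalEquality using (_≡_)
open import Relation.Nullary using (¬_)

open import Data.Bool using (T)
open import Data.Empty using (⊥-elim)
open import Data.List using (_++_; [_])
open import Data.List.Properties using (map-++; ++-assoc; ++-identityʳ; ≡-dec)
open import Data.List.Relation.Binary.Pointwise using (Pointwise; []; _∷_)
open import Data.List.Relation.Unary.All as All using (All; []; _∷_)
open import Data.List.Relation.Unary.Linked using ([-]; _∷_)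
open import Data.List.Relation.Unary.Linked.Properties using (Linked⇒All)
open import Data.Nat using (suc; _+_; _*_; _≤′_; ≤′-reflexive; ≤′-step; _≤ᵇ_; s≤s)
open import Data.Nat.ListAction.Properties using (product-++)
open import Data.Nat.Properties
open import Data.Nat.Solver using (module +-*-Solver)
open import Data.Product using (_,_)
open import Algebra.Properties.CommutativeSemigroup *-commutativeSemigroup using (x∙yz≈y∙xz)
open import Data.List.Membership.DecPropositional (≡-dec _≟_) using (_∈?_; _∉_)
open import Function using (id)
open import Relation.Binary.PropositionalEquality
  using (refl; sym; trans; cong; cong₂; subst; module ≡-Reasoning)
open import Relation.Nullary.Decidable using (True; toWitness)

computed : ∀ {m n} {_ : T (m ≤ᵇ n)} → m ≤ n
computed {m} {n} {m≤ᵇn} = ≤ᵇ⇒≤ m n m≤ᵇn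

listed : ∀ {ns} {_ : True (ns ∈? exceptions)} → ns ∈ exceptions
listed {_} {ns∈?} = toWitness ns∈?

infix 4 _²≤2^_

_²≤2^_ : ℕ → ℕ → Set
P ²≤2^ S = P ^ 2 ≤ 2 ^ S

square-* : ∀ k x → (k * x) ^ 2 ≡ k ^ 2 * x ^ 2
square-* = solve 2 (λ k x → (k :* x) :^ 2 := k :^ 2 :* x :^ 2) refl
  where open +-*-Solver

²≤2^-step : ∀ j P {S} → 2 ≤ S →
  suc j * P ²≤2^ j * S → suc (suc j) * P ²≤2^ suc j * S
²≤2^-step j P {S} 2≤S h = begin
  (suc (suc j) * P) ^ 2  ≤⟨ ^-monoˡ-≤ 2 (+-mono-≤ (m≤m+n P (j * P)) (m≤m+n X 0)) ⟩
  (2 * X) ^ 2            ≡⟨ square-* 2 X ⟩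
  2 ^ 2 * X ^ 2          ≤⟨ *-monoʳ-≤ (2 ^ 2) h ⟩
  2 ^ 2 * 2 ^ (j * S)    ≡⟨ ^-distribˡ-+-* 2 2 (j * S) ⟨
  2 ^ (2 + j * S)        ≤⟨ ^-monoʳ-≤ 2 (+-monoˡ-≤ (j * S) 2≤S) ⟩
  2 ^ (suc j * S)        ∎
  where
  open ≤-Reasoning
  X = suc j * P

²≤2^-mono : ∀ P {a b S} → 2 ≤ S → 1 ≤ a → a ≤ b →
  a * P ²≤2^ (a ∸ 1) * S → b * P ²≤2^ (b ∸ 1) * S
²≤2^-mono P {suc a} {b} {S} 2≤S _ a≤b = go (≤⇒≤′ a≤b)
  where
  go : ∀ {b} → suc a ≤′ b → suc a * P ²≤2^ a * S → b * P ²≤2^ (b ∸ 1) * S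
  go (≤′-reflexive refl)            h = h
  go (≤′-step {0} (≤′-reflexive ()))
  go (≤′-step {suc b} a≤′b)         h = ²≤2^-step b P 2≤S (go a≤′b h)

²≤2^-triple : ∀ P {S} → 4 ≤ S → P ²≤2^ S → 3 * P ²≤2^ 2 * S
²≤2^-triple P {S} 4≤S h = begin
  (3 * P) ^ 2    ≤⟨ ^-monoˡ-≤ 2 (*-monoˡ-≤ P (n≤1+n 3)) ⟩
  (4 * P) ^ 2    ≡⟨ square-* 4 P ⟩
  2 ^ 4 * P ^ 2  ≤⟨ *-monoʳ-≤ (2 ^ 4) h ⟩
  2 ^ 4 * 2 ^ S  ≡⟨ ^-distribˡ-+-* 2 4 S ⟨
  2 ^ (4 + S)    ≤⟨ ^-monoʳ-≤ 2 (+-mono-≤ 4≤S (m≤m+n S 0)) ⟩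
  2 ^ (2 * S)    ∎
  where open ≤-Reasoning

predProduct : List ℕ → ℕ
predProduct ns = product (map (λ n → n ∸ 1) ns)

-- A record rather than a definition, so that Agda compares LogBound ms and
-- LogBound ns by comparing the lists instead of unfolding the powers of 2.
record LogBound (ns : List ℕ) : Set where
  constructor logBound
  field bound : product ns ²≤2^ predProduct ns

open LogBound using (bound)

product-insert : ∀ ms ns x → product (ms ++ x ∷ ns) ≡ x * product (ms ++ ns)
product-insert []       ns x = refl
product-insert (m ∷ ms) ns x =
  trans (cong (m *_) (product-insert ms ns x)) (x∙yz≈y∙xz m x (product (ms ++ ns)))

predProduct-insert : ∀ ms ns x →
  predProduct (ms ++ x ∷ ns) ≡ (x ∸ 1) * predProduct (ms ++ ns)
predProduct-insert ms ns x = begin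
  product (map f (ms ++ x ∷ ns))         ≡⟨ cong product (map-++ f ms (x ∷ ns)) ⟩
  product (map f ms ++ f x ∷ map f ns)   ≡⟨ product-insert (map f ms) (map f ns) (f x) ⟩
  f x * product (map f ms ++ map f ns)   ≡⟨ cong (λ ks → f x * product ks) (map-++ f ms ns) ⟨
  f x * product (map f (ms ++ ns))       ∎
  where
  open ≡-Reasoning
  f = λ n → n ∸ 1

predProduct-++ : ∀ ms ns → predProduct (ms ++ ns) ≡ predProduct ms * predProduct ns
predProduct-++ ms ns =
  trans (cong product (map-++ _ ms ns)) (product-++ (map _ ms) (map _ ns))

predProduct-mono : ∀ {ms ns} → Pointwise _≤_ ms ns → predProduct ms ≤ predProduct ns
predProduct-mono []            = ≤-refl
predProduct-mono (m≤n ∷ ms≤ns) = *-mono-≤ (∸-monoˡ-≤ 1 m≤n) (predProduct-mono ms≤ns)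

predProduct-≥ : ∀ {k} ms {ns} → k ≤ predProduct ms → Pointwise _≤_ ms ns → k ≤ predProduct ns
predProduct-≥ ms k≤ ms≤ns = ≤-trans k≤ (predProduct-mono ms≤ns)

predProduct-positive : ∀ {ns} → All (2 ≤_) ns → 1 ≤ predProduct ns
predProduct-positive []                = ≤-refl
predProduct-positive (s≤s 1≤n ∷ 2≤ns) = *-mono-≤ 1≤n (predProduct-positive 2≤ns)

bound-insert : ∀ ms ns x →
  (product (ms ++ x ∷ ns) ²≤2^ predProduct (ms ++ x ∷ ns)) ≡
  (x * product (ms ++ ns) ²≤2^ (x ∸ 1) * predProduct (ms ++ ns))
bound-insert ms ns x = cong₂ _²≤2^_ (product-insert ms ns x) (predProduct-insert ms ns x)

LogBound-raise : ∀ ms ns {x y} → 2 ≤ predProduct (ms ++ ns) → 1 ≤ x → x ≤ y →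
  LogBound (ms ++ x ∷ ns) → LogBound (ms ++ y ∷ ns)
LogBound-raise ms ns {x} {y} 2≤S 1≤x x≤y (logBound h) = logBound
  (subst id (sym (bound-insert ms ns y))
    (²≤2^-mono (product (ms ++ ns)) 2≤S 1≤x x≤y (subst id (bound-insert ms ns x) h)))

LogBound-insert-three : ∀ ms ns → 4 ≤ predProduct (ms ++ ns) →
  LogBound (ms ++ ns) → LogBound (ms ++ 3 ∷ ns)
LogBound-insert-three ms ns 4≤S (logBound h) = logBound
  (subst id (sym (bound-insert ms ns 3)) (²≤2^-triple (product (ms ++ ns)) 4≤S h))

LogBound-raiseAll : ∀ ms ns {ns′} → 2 ≤ predProduct ms → All (2 ≤_) ns →
  Pointwise _≤_ ns ns′ → LogBound (ms ++ ns) → LogBound (ms ++ ns′)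
LogBound-raiseAll ms [] _ [] [] h = h
LogBound-raiseAll ms (x ∷ ns) {y ∷ ns′} 2≤S (2≤x ∷ 2≤ns) (x≤y ∷ ns≤ns′) h =
  subst LogBound (++-assoc ms [ y ] ns′)
    (LogBound-raiseAll (ms ++ [ y ]) ns (2≤predProduct [ y ] (≤-trans 2≤x x≤y ∷ []))
      2≤ns ns≤ns′
      (subst LogBound (sym (++-assoc ms [ y ] ns))
        (LogBound-raise ms ns (2≤predProduct ns 2≤ns) (<⇒≤ 2≤x) x≤y h)))
  where
  2≤predProduct : ∀ ks → All (2 ≤_) ks → 2 ≤ predProduct (ms ++ ks)
  2≤predProduct ks 2≤ks = subst (2 ≤_) (sym (predProduct-++ ms ks))
    (*-mono-≤ 2≤S (predProduct-positive 2≤ks))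

LogBound-extend : ∀ ms {ns} → 4 ≤ predProduct ms → All (3 ≤_) ns →
  LogBound ms → LogBound (ms ++ ns)
LogBound-extend ms {[]}     _   []           h = subst LogBound (sym (++-identityʳ ms)) h
LogBound-extend ms {x ∷ ns} 4≤S (3≤x ∷ 3≤ns) h =
  LogBound-raise ms ns (≤-trans computed 4≤S′) computed 3≤x
    (LogBound-insert-three ms ns 4≤S′ (LogBound-extend ms 4≤S 3≤ns h))
  where
  4≤S′ : 4 ≤ predProduct (ms ++ ns)
  4≤S′ = subst (4 ≤_) (sym (predProduct-++ ms ns))
    (*-mono-≤ 4≤S (predProduct-positive (All.map <⇒≤ 3≤ns)))

-- Short sorted tuples are parametrised by their increments (n₁ = 3 + i,
-- n₂ = n₁ + j, …), so that the case analysis has no impossible cases.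
LogBound-pair : ∀ i j → 3 + i ∷ 3 + i + j ∷ [] ∉ exceptions →
  LogBound (3 + i ∷ 3 + i + j ∷ [])
LogBound-pair 0 0 ∉ = ⊥-elim (∉ listed)
LogBound-pair 0 1 ∉ = ⊥-elim (∉ listed)
LogBound-pair 0 (suc (suc j)) _ =
  LogBound-raise [ 3 ] [] computed computed (m≤m+n 5 j) (logBound computed)
LogBound-pair (suc i) j _ =
  LogBound-raiseAll [ 4 + i ] [ 4 ] (predProduct-≥ [ 4 ] computed (m≤m+n 4 i ∷ []))
    (computed ∷ []) (m≤m+n 4 (i + j) ∷ [])
    (LogBound-raise [] [ 4 ] computed computed (m≤m+n 4 i) (logBound computed))

LogBound-2-triple : ∀ j k → 2 ∷ 3 + j ∷ 3 + j + k ∷ [] ∉ exceptions →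
  LogBound (2 ∷ 3 + j ∷ 3 + j + k ∷ [])
LogBound-2-triple 0 0 ∉ = ⊥-elim (∉ listed)
LogBound-2-triple 0 1 ∉ = ⊥-elim (∉ listed)
LogBound-2-triple 0 2 ∉ = ⊥-elim (∉ listed)
LogBound-2-triple 0 3 ∉ = ⊥-elim (∉ listed)
LogBound-2-triple 0 (suc (suc (suc (suc k)))) _ =
  LogBound-raise (2 ∷ 3 ∷ []) [] computed computed (m≤m+n 7 k) (logBound computed)
LogBound-2-triple 1 0 ∉ = ⊥-elim (∉ listed)
LogBound-2-triple 1 (suc k) _ =
  LogBound-raise (2 ∷ 4 ∷ []) [] computed computed (m≤m+n 5 k) (logBound computed)
LogBound-2-triple (suc (suc j)) k _ =
  LogBound-raiseAll (2 ∷ 5 + j ∷ []) [ 5 ]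
    (predProduct-≥ (2 ∷ 5 ∷ []) computed (≤-refl ∷ m≤m+n 5 j ∷ []))
    (computed ∷ []) (m≤m+n 5 (j + k) ∷ [])
    (LogBound-raise [ 2 ] [ 5 ] computed computed (m≤m+n 5 j) (logBound computed))

LogBound-3-triple : ∀ i j k → 3 + i ∷ 3 + i + j ∷ 3 + i + j + k ∷ [] ∉ exceptions →
  LogBound (3 + i ∷ 3 + i + j ∷ 3 + i + j + k ∷ [])
LogBound-3-triple 0 0 0 ∉ = ⊥-elim (∉ listed)
LogBound-3-triple 0 0 (suc k) _ =
  LogBound-raise (3 ∷ 3 ∷ []) [] computed computed (m≤m+n 4 k) (logBound computed)
LogBound-3-triple 0 (suc j) k _ =
  LogBound-raiseAll [ 3 ] (4 ∷ 4 ∷ []) computed (computed ∷ computed ∷ [])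
    (m≤m+n 4 j ∷ m≤m+n 4 (j + k) ∷ []) (logBound computed)
LogBound-3-triple (suc i) j k _ =
  LogBound-raiseAll [ 4 + i ] (4 ∷ 4 ∷ []) (predProduct-≥ [ 4 ] computed (m≤m+n 4 i ∷ []))
    (computed ∷ computed ∷ []) (m≤m+n 4 (i + j) ∷ m≤m+n 4 (i + j + k) ∷ [])
    (LogBound-raise [] (4 ∷ 4 ∷ []) computed computed (m≤m+n 4 i) (logBound computed))

LogBound-2-quadruple : ∀ j k l →
  2 ∷ 3 + j ∷ 3 + j + k ∷ 3 + j + k + l ∷ [] ∉ exceptions →
  LogBound (2 ∷ 3 + j ∷ 3 + j + k ∷ 3 + j + k + l ∷ [])
LogBound-2-quadruple 0 0 0 ∉ = ⊥-elim (∉ listed)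
LogBound-2-quadruple 0 0 1 ∉ = ⊥-elim (∉ listed)
LogBound-2-quadruple 0 0 (suc (suc l)) _ =
  LogBound-raise (2 ∷ 3 ∷ 3 ∷ []) [] computed computed (m≤m+n 5 l) (logBound computed)
LogBound-2-quadruple 0 (suc k) l _ =
  LogBound-raiseAll (2 ∷ 3 ∷ []) (4 ∷ 4 ∷ []) computed (computed ∷ computed ∷ [])
    (m≤m+n 4 k ∷ m≤m+n 4 (k + l) ∷ []) (logBound computed)
LogBound-2-quadruple (suc j) k l _ =
  LogBound-raiseAll (2 ∷ 4 + j ∷ []) (4 ∷ 4 ∷ [])
    (predProduct-≥ (2 ∷ 4 ∷ []) computed (≤-refl ∷ m≤m+n 4 j ∷ []))
    (computed ∷ computed ∷ []) (m≤m+n 4 (j + k) ∷ m≤m+n 4 (j + k + l) ∷ [])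
    (LogBound-raise [ 2 ] (4 ∷ 4 ∷ []) computed computed (m≤m+n 4 j) (logBound computed))

LogBound-3-quadruple : ∀ {a b c d} → All (3 ≤_) (a ∷ b ∷ c ∷ d ∷ []) →
  LogBound (a ∷ b ∷ c ∷ d ∷ [])
LogBound-3-quadruple {a} (3≤a ∷ 3≤b ∷ 3≤c ∷ 3≤d ∷ []) =
  LogBound-raiseAll [ a ] (3 ∷ 3 ∷ 3 ∷ []) (predProduct-≥ [ 3 ] computed (3≤a ∷ []))
    (computed ∷ computed ∷ computed ∷ []) (3≤b ∷ 3≤c ∷ 3≤d ∷ [])
    (LogBound-raise [] (3 ∷ 3 ∷ 3 ∷ []) computed computed 3≤a (logBound computed))

LogBound-long : ∀ {a b c d e ns} → 2 ≤ a → All (3 ≤_) (b ∷ c ∷ d ∷ e ∷ ns) →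
  LogBound (a ∷ b ∷ c ∷ d ∷ e ∷ ns)
LogBound-long {a} {b} {c} {d} {e} 2≤a (3≤b ∷ 3≤c ∷ 3≤d ∷ 3≤e ∷ 3≤ns) =
  LogBound-extend (a ∷ b ∷ c ∷ d ∷ e ∷ [])
    (predProduct-≥ (2 ∷ 3 ∷ 3 ∷ 3 ∷ 3 ∷ []) computed (2≤a ∷ 3≤b ∷ 3≤c ∷ 3≤d ∷ 3≤e ∷ []))
    3≤ns LogBound-a-b-c-d-e
  where
  LogBound-a-3-3-3-3 : LogBound (a ∷ 3 ∷ 3 ∷ 3 ∷ 3 ∷ [])
  LogBound-a-3-3-3-3 =
    LogBound-raise [] (3 ∷ 3 ∷ 3 ∷ 3 ∷ []) computed computed 2≤a (logBound computed)
  LogBound-a-b-3-3-3 : LogBound (a ∷ b ∷ 3 ∷ 3 ∷ 3 ∷ [])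
  LogBound-a-b-3-3-3 = LogBound-raise [ a ] (3 ∷ 3 ∷ 3 ∷ [])
    (predProduct-≥ (2 ∷ 3 ∷ 3 ∷ 3 ∷ []) computed (2≤a ∷ ≤-refl ∷ ≤-refl ∷ ≤-refl ∷ []))
    computed 3≤b LogBound-a-3-3-3-3
  LogBound-a-b-c-d-e : LogBound (a ∷ b ∷ c ∷ d ∷ e ∷ [])
  LogBound-a-b-c-d-e = LogBound-raiseAll (a ∷ b ∷ []) (3 ∷ 3 ∷ 3 ∷ [])
    (predProduct-≥ (2 ∷ 3 ∷ []) computed (2≤a ∷ 3≤b ∷ []))
    (computed ∷ computed ∷ computed ∷ []) (3≤c ∷ 3≤d ∷ 3≤e ∷ []) LogBound-a-b-3-3-3

proposition5p4 : (n₁ n₂ : ℕ) (rest : List ℕ) →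
    Linked _≤_ (n₁ ∷ n₂ ∷ rest) → 2 ≤ n₁ → 3 ≤ n₂ → (rest ≡ [] → 3 ≤ n₁) →
    ¬ ((n₁ ∷ n₂ ∷ rest) ∈ exceptions) →
    product (n₁ ∷ n₂ ∷ rest) ^ 2 ≤ 2 ^ product (map (λ n → n ∸ 1) (n₁ ∷ n₂ ∷ rest))
proposition5p4 1 _ _ _ (s≤s ()) _ _ _
proposition5p4 2 _ [] _ _ _ 3≤2 _ = ⊥-elim (<-irrefl refl (3≤2 refl))
proposition5p4 (suc (suc (suc i))) _ [] (n₁≤n₂ ∷ [-]) _ _ _ ∉
  with j , refl ← m≤n⇒∃[o]m+o≡n n₁≤n₂ = bound (LogBound-pair i j ∉)
proposition5p4 2 _ (_ ∷ []) (_ ∷ n₂≤n₃ ∷ [-]) _ 3≤n₂ _ ∉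
  with j , refl ← m≤n⇒∃[o]m+o≡n 3≤n₂
     | k , refl ← m≤n⇒∃[o]m+o≡n n₂≤n₃ = bound (LogBound-2-triple j k ∉)
proposition5p4 (suc (suc (suc i))) _ (_ ∷ []) (n₁≤n₂ ∷ n₂≤n₃ ∷ [-]) _ _ _ ∉
  with j , refl ← m≤n⇒∃[o]m+o≡n n₁≤n₂
     | k , refl ← m≤n⇒∃[o]m+o≡n n₂≤n₃ = bound (LogBound-3-triple i j k ∉)
proposition5p4 2 _ (_ ∷ _ ∷ []) (_ ∷ n₂≤n₃ ∷ n₃≤n₄ ∷ [-]) _ 3≤n₂ _ ∉
  with j , refl ← m≤n⇒∃[o]m+o≡n 3≤n₂
     | k , refl ← m≤n⇒∃[o]m+o≡n n₂≤n₃
     | l , refl ← m≤n⇒∃[o]m+o≡n n₃≤n₄ = bound (LogBound-2-quadruple j k l ∉)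
proposition5p4 (suc (suc (suc i))) _ (_ ∷ _ ∷ []) (_ ∷ n₂≤rest) _ 3≤n₂ _ _ =
  bound (LogBound-3-quadruple (m≤m+n 3 i ∷ Linked⇒All ≤-trans 3≤n₂ n₂≤rest))
proposition5p4 _ _ (_ ∷ _ ∷ _ ∷ _) (_ ∷ n₂≤rest) 2≤n₁ 3≤n₂ _ _ =
  bound (LogBound-long 2≤n₁ (Linked⇒All ≤-trans 3≤n₂ n₂≤rest))
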